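{- Every generalized Petersen graph $P_{n,k}$ is $\alpha$-excellent.
   Context: All graphs are finite and simple. A graph is $\alpha$-excellent if every vertex is contained in some maximum independent set. For integers $n\ge 3$ and $k\in\{1,\ldots,n-1\}$, the generalized Petersen graph $P_{n,k}$ has vertices $v_0,\ldots,v_{n-1},u_0,\ldots,u_{n-1}$ and edges $v_iv_{i+1}$, $v_iu_i$, $u_iu_{i+k}$ for $i\in\{0,\ldots,n-1\}$, with subscripts taken modulo $n$. -}

module Defs where

open import Data.Nat using (ℕ; _+_; _%_; _≤_; NonZero)
open import Data.Fin using (Fin; toℕ; splitAt)
open import Data.Fin.Subset using (Subset; _∈_; ∣_∣)
open import Data.Product using (_×_; Σ)
open import Data.Sum using (_⊎_; inj₁; inj₂)
open import Relation.Nullary using (¬_)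
open import Relation.Binary.PropositionalEquality using (_≡_)

Independent : ∀ {m} → (Fin m → Fin m → Set) → Subset m → Set
Independent Adj S = ∀ x y → x ∈ S → y ∈ S → ¬ Adj x y

MaximumIndependent : ∀ {m} → (Fin m → Fin m → Set) → Subset m → Set
MaximumIndependent Adj S =
  Independent Adj S × (∀ T → Independent Adj T → ∣ T ∣ ≤ ∣ S ∣)

AlphaExcellent : ∀ {m} → (Fin m → Fin m → Set) → Set
AlphaExcellent {m} Adj =
  ∀ (x : Fin m) → Σ (Subset m) λ S → MaximumIndependent Adj S × x ∈ S

-- Generalized Petersen graph P_{n,k} on vertex set Fin (n + n):
-- vertex x with  splitAt n x = inj₁ i  is v_i, with  inj₂ i  it is u_i.
data PEdge (n k : ℕ) .{{_ : NonZero n}} : (Fin n ⊎ Fin n) → (Fin n ⊎ Fin n) → Set where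
  outer : ∀ i j → toℕ j ≡ (toℕ i + 1) % n → PEdge n k (inj₁ i) (inj₁ j)
  spoke : ∀ i → PEdge n k (inj₁ i) (inj₂ i)
  inner : ∀ i j → toℕ j ≡ (toℕ i + k) % n → PEdge n k (inj₂ i) (inj₂ j)

PAdj : (n k : ℕ) .{{_ : NonZero n}} → Fin (n + n) → Fin (n + n) → Set
PAdj n k x y = PEdge n k (splitAt n x) (splitAt n y) ⊎ PEdge n k (splitAt n y) (splitAt n x)

{-# OPTIONS --safe #-}
-- The rotation i ↦ i + t of both cycles is an automorphism of P_{n,k}, and the preimage of a
-- maximum independent set under an automorphism is again one. The rotations act transitively on
-- each cycle, so it suffices that every maximum independent set S meets both cycles. If S
-- contained no v_i, then each v_i ∉ S, whose only possible neighbour in S is u_i, would force u_i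
-- into S by maximality; but then S contains the inner edge u_0 u_k. Symmetrically, S meets the
-- inner cycle because the outer edge v_0 v_1 cannot lie in S.
module Submission where

open import Defs
open import Data.Bool.Base using (Bool; true; false; if_then_else_)
open import Data.Empty using (⊥-elim)
open import Data.Fin.Base using (Fin; toℕ; fromℕ<; splitAt; join)
open import Data.Fin.Permutation using (Permutation′; _⟨$⟩ʳ_)
open import Data.Fin.Properties
  using (all?; any?; toℕ-fromℕ<; toℕ-injective; toℕ<n; splitAt-join; join-splitAt; +↔⊎)
  renaming (_≟_ to _≟ᶠ_)
open import Data.Fin.Subset using (Subset; _∈_; _∉_; _∪_; _⊂_; ⁅_⁆; ∣_∣; ⊥)
open import Data.Fin.Subset.Properties
  using ( _∈?_; anySubset?; ∣p∣≤n; p⊂q⇒∣p∣<∣q∣; x∈p∪q⁻; x∈⁅y⁆⇒x≡y; x∈⁅x⁆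
        ; p⊆p∪q; q⊆p∪q; ∉⊥)
open import Data.Nat.Base
  using (ℕ; suc; pred; _+_; _*_; _∸_; _%_; _/_; _<_; _≤_; z≤n; s≤s; NonZero; >-nonZero; >-nonZero⁻¹)
open import Data.Nat.DivMod using (m%n<n; m≡m%n+[m/n]*n; [m+kn]%n≡m%n; [m+n]%n≡m%n; m<n⇒m%n≡m)
open import Data.Nat.Divisibility using (divides; ∣⇒≤)
open import Data.Nat.Induction using (<-wellFounded)
open import Data.Nat.Properties
  using ( +-0-commutativeMonoid; _≟_; _<?_; +-comm; +-assoc; *-suc; suc-pred; +-cancelˡ-≡; m+[n∸m]≡n
        ; ∸-monoʳ-<; ≮⇒≥; <⇒≱; <-irrefl; <-≤-trans; <⇒≤; ≤-trans; n≤1+n)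
open import Algebra.Properties.CommutativeMonoid.Sum +-0-commutativeMonoid
  using (sum; sum-cong-≗; sum-permute)
open import Data.Product using (Σ; ∃; _×_; _,_; proj₁; proj₂)
open import Data.Sum as Sum using (_⊎_; inj₁; inj₂; [_,_]′)
open import Data.Vec.Base using ([]; _∷_; tabulate; lookup)
open import Data.Vec.Properties using (lookup∘tabulate; []=⇒lookup; lookup⇒[]=)
open import Function.Base using (_∘_; id)
open import Function.Bundles using (_↔_; mk↔ₛ′)
open import Function.Properties.Inverse using (↔-trans; ↔-sym)
open import Induction.WellFounded using (Acc; acc)
open import Relation.Binary.Core using (_Preserves_⟶_)
open import Relation.Binary.Definitions using (Decidable; Symmetric)
open import Relation.Binary.PropositionalEquality
  using (_≡_; _≢_; refl; sym; trans; cong; cong₂; subst; module ≡-Reasoning)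
open import Relation.Nullary using (Dec; yes; no; ¬_)
open import Relation.Nullary.Decidable using (_×-dec_; _→-dec_; _⊎-dec_; ¬?; map′)

largest : ∀ {m} {P : Subset m → Set} → (∀ S → Dec (P S)) → ∀ {S₀} → P S₀ →
          Σ (Subset m) λ S → P S × (∀ T → P T → ∣ T ∣ ≤ ∣ S ∣)
largest {m} {P} P? = go (<-wellFounded _)
  where
  go : ∀ {S} → Acc _<_ (m ∸ ∣ S ∣) → P S →
       Σ (Subset m) λ M → P M × (∀ T → P T → ∣ T ∣ ≤ ∣ M ∣)
  go {S} (acc rec) pS with anySubset? (λ T → P? T ×-dec ∣ S ∣ <? ∣ T ∣)
  ... | yes (T , pT , S<T) = go (rec (∸-monoʳ-< S<T (∣p∣≤n T))) pT
  ... | no ∄larger = S , pS , λ T pT → ≮⇒≥ (λ S<T → ∄larger (T , pT , S<T))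

preimage : ∀ {m} → (Fin m → Fin m) → Subset m → Subset m
preimage f S = tabulate (lookup S ∘ f)

module _ {m} (f : Fin m → Fin m) (S : Subset m) where

  x∈preimage⇒fx∈S : ∀ {x} → x ∈ preimage f S → f x ∈ S
  x∈preimage⇒fx∈S {x} x∈ =
    lookup⇒[]= (f x) S (trans (sym (lookup∘tabulate (lookup S ∘ f) x)) ([]=⇒lookup x∈))

  fx∈S⇒x∈preimage : ∀ {x} → f x ∈ S → x ∈ preimage f S
  fx∈S⇒x∈preimage {x} fx∈S =
    lookup⇒[]= x (preimage f S) (trans (lookup∘tabulate (lookup S ∘ f) x) ([]=⇒lookup fx∈S))

∣p∣≡∑ : ∀ {m} (p : Subset m) → ∣ p ∣ ≡ sum (λ i → if lookup p i then 1 else 0)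
∣p∣≡∑ []          = refl
∣p∣≡∑ (true ∷ p)  = cong suc (∣p∣≡∑ p)
∣p∣≡∑ (false ∷ p) = ∣p∣≡∑ p

∣preimage∣ : ∀ {m} (π : Permutation′ m) S → ∣ preimage (π ⟨$⟩ʳ_) S ∣ ≡ ∣ S ∣
∣preimage∣ π S = begin
  ∣ preimage (π ⟨$⟩ʳ_) S ∣                     ≡⟨ ∣p∣≡∑ (preimage (π ⟨$⟩ʳ_) S) ⟩
  sum (indicator ∘ lookup (tabulate Sπ))      ≡⟨ sum-cong-≗ (cong indicator ∘ lookup∘tabulate Sπ) ⟩
  sum (indicator ∘ Sπ)                        ≡⟨ sum-permute (indicator ∘ lookup S) π ⟨
  sum (indicator ∘ lookup S)                  ≡⟨ ∣p∣≡∑ S ⟨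
  ∣ S ∣                                       ∎
  where
  open ≡-Reasoning
  indicator : Bool → ℕ
  indicator b = if b then 1 else 0
  Sπ : Fin _ → Bool
  Sπ = lookup S ∘ (π ⟨$⟩ʳ_)

InSomeMaximum : ∀ {m} → (Fin m → Fin m → Set) → Fin m → Set
InSomeMaximum {m} Adj x = Σ (Subset m) λ S → MaximumIndependent Adj S × x ∈ S

module _ {m} {Adj : Fin m → Fin m → Set} where

  preimage-maximumIndependent : (π : Permutation′ m) → (π ⟨$⟩ʳ_) Preserves Adj ⟶ Adj → ∀ {S} →
                                MaximumIndependent Adj S → MaximumIndependent Adj (preimage (π ⟨$⟩ʳ_) S)
  preimage-maximumIndependent π π-hom {S} (ind , max) =
    (λ x y x∈ y∈ → ind _ _ (x∈preimage⇒fx∈S _ S x∈) (x∈preimage⇒fx∈S _ S y∈) ∘ π-hom) ,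
    (λ T indT → subst (∣ T ∣ ≤_) (sym (∣preimage∣ π S)) (max T indT))

  InSomeMaximum-preimage : (π : Permutation′ m) → (π ⟨$⟩ʳ_) Preserves Adj ⟶ Adj →
                           ∀ {x} → InSomeMaximum Adj (π ⟨$⟩ʳ x) → InSomeMaximum Adj x
  InSomeMaximum-preimage π π-hom (S , max , πx∈S) =
    preimage (π ⟨$⟩ʳ_) S , preimage-maximumIndependent π π-hom max , fx∈S⇒x∈preimage _ S πx∈S

  independent? : Decidable Adj → ∀ S → Dec (Independent Adj S)
  independent? adj? S = all? λ x → all? λ y → x ∈? S →-dec (y ∈? S →-dec ¬? (adj? x y))

  maximumIndependent-exists : Decidable Adj → Σ (Subset m) (MaximumIndependent Adj)
  maximumIndependent-exists adj? = largest (independent? adj?) {⊥} (λ _ _ x∈⊥ _ _ → ∉⊥ x∈⊥)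

  maximum⇒dominating : Symmetric Adj → ∀ {S b} → MaximumIndependent Adj S → ¬ Adj b b → b ∉ S →
                       ¬ (∀ y → y ∈ S → ¬ Adj b y)
  maximum⇒dominating sym-adj {S} {b} (ind , max) ¬bb b∉S b-free =
    <-irrefl refl (<-≤-trans (p⊂q⇒∣p∣<∣q∣ S⊂S+b) (max (S ∪ ⁅ b ⁆) S+b-independent))
    where
    S⊂S+b : S ⊂ S ∪ ⁅ b ⁆
    S⊂S+b = (λ {_} → p⊆p∪q ⁅ b ⁆) , b , q⊆p∪q S ⁅ b ⁆ (x∈⁅x⁆ b) , b∉S
    S+b-independent : Independent Adj (S ∪ ⁅ b ⁆)
    S+b-independent x y x∈ y∈ with x∈p∪q⁻ S ⁅ b ⁆ x∈ | x∈p∪q⁻ S ⁅ b ⁆ y∈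
    ... | inj₁ x∈S | inj₁ y∈S = ind x y x∈S y∈S
    ... | inj₁ x∈S | inj₂ y≡b rewrite x∈⁅y⁆⇒x≡y b y≡b = b-free x x∈S ∘ sym-adj
    ... | inj₂ x≡b | inj₁ y∈S rewrite x∈⁅y⁆⇒x≡y b x≡b = b-free y y∈S
    ... | inj₂ x≡b | inj₂ y≡b rewrite x∈⁅y⁆⇒x≡y b x≡b | x∈⁅y⁆⇒x≡y b y≡b = ¬bb

  maximum⇒forced : Symmetric Adj → ∀ {S b c} → MaximumIndependent Adj S → ¬ Adj b b → b ∉ S →
                   (∀ {y} → y ∈ S → Adj b y → y ≡ c) → c ∈ S
  maximum⇒forced sym-adj {S} {b} {c} max ¬bb b∉S only-c with c ∈? S
  ... | yes c∈S = c∈S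
  ... | no c∉S  = ⊥-elim (maximum⇒dominating sym-adj max ¬bb b∉S
                    λ y y∈S bAy → c∉S (subst (_∈ S) (only-c y∈S bAy) y∈S))

∀-join : ∀ {m n} {P : Fin (m + n) → Set} → (∀ s → P (join m n s)) → ∀ x → P x
∀-join {m} {n} {P} p x = subst P (join-splitAt m n x) (p (splitAt m x))

module _ {n : ℕ} .{{_ : NonZero n}} where

  infixl 6 _⊕_
  _⊕_ : Fin n → ℕ → Fin n
  i ⊕ t = fromℕ< (m%n<n (toℕ i + t) n)

  toℕ-⊕ : ∀ i t → toℕ (i ⊕ t) ≡ (toℕ i + t) % n
  toℕ-⊕ i t = toℕ-fromℕ< (m%n<n (toℕ i + t) n)

  [m%n+k]%n≡[m+k]%n : ∀ m k → (m % n + k) % n ≡ (m + k) % n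
  [m%n+k]%n≡[m+k]%n m k = begin
    (m % n + k) % n                  ≡⟨ [m+kn]%n≡m%n (m % n + k) (m / n) n ⟨
    (m % n + k + m / n * n) % n      ≡⟨ cong (_% n) (+-comm (m % n + k) (m / n * n)) ⟩
    (m / n * n + (m % n + k)) % n    ≡⟨ cong (_% n) (+-assoc (m / n * n) (m % n) k) ⟨
    (m / n * n + m % n + k) % n      ≡⟨ cong (λ z → (z + k) % n) (+-comm (m / n * n) (m % n)) ⟩
    (m % n + m / n * n + k) % n      ≡⟨ cong (λ z → (z + k) % n) (m≡m%n+[m/n]*n m n) ⟨
    (m + k) % n                      ∎
    where open ≡-Reasoning

  ⊕-⊕ : ∀ i s t → i ⊕ s ⊕ t ≡ i ⊕ (s + t)
  ⊕-⊕ i s t = toℕ-injective (begin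
    toℕ (i ⊕ s ⊕ t)            ≡⟨ toℕ-⊕ (i ⊕ s) t ⟩
    (toℕ (i ⊕ s) + t) % n      ≡⟨ cong (λ z → (z + t) % n) (toℕ-⊕ i s) ⟩
    ((toℕ i + s) % n + t) % n  ≡⟨ [m%n+k]%n≡[m+k]%n (toℕ i + s) t ⟩
    (toℕ i + s + t) % n        ≡⟨ cong (_% n) (+-assoc (toℕ i) s t) ⟩
    (toℕ i + (s + t)) % n      ≡⟨ toℕ-⊕ i (s + t) ⟨
    toℕ (i ⊕ (s + t))          ∎)
    where open ≡-Reasoning

  ⊕-comm : ∀ i s t → i ⊕ s ⊕ t ≡ i ⊕ t ⊕ s
  ⊕-comm i s t = trans (⊕-⊕ i s t) (trans (cong (i ⊕_) (+-comm s t)) (sym (⊕-⊕ i t s)))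

  ⊕-multiple : ∀ i c → i ⊕ c * n ≡ i
  ⊕-multiple i c = toℕ-injective (begin
    toℕ (i ⊕ c * n)            ≡⟨ toℕ-⊕ i (c * n) ⟩
    (toℕ i + c * n) % n        ≡⟨ [m+kn]%n≡m%n (toℕ i) c n ⟩
    toℕ i % n                  ≡⟨ m<n⇒m%n≡m (toℕ<n i) ⟩
    toℕ i                      ∎)
    where open ≡-Reasoning

  ⊕-reaches : ∀ i j → i ⊕ (n ∸ toℕ i + toℕ j) ≡ j
  ⊕-reaches i j = toℕ-injective (begin
    toℕ (i ⊕ (n ∸ toℕ i + toℕ j))       ≡⟨ toℕ-⊕ i (n ∸ toℕ i + toℕ j) ⟩
    (toℕ i + (n ∸ toℕ i + toℕ j)) % n   ≡⟨ cong (_% n) (+-assoc (toℕ i) (n ∸ toℕ i) (toℕ j)) ⟨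
    (toℕ i + (n ∸ toℕ i) + toℕ j) % n   ≡⟨ cong (λ z → (z + toℕ j) % n) (m+[n∸m]≡n (<⇒≤ (toℕ<n i))) ⟩
    (n + toℕ j) % n                     ≡⟨ cong (_% n) (+-comm n (toℕ j)) ⟩
    (toℕ j + n) % n                     ≡⟨ [m+n]%n≡m%n (toℕ j) n ⟩
    toℕ j % n                           ≡⟨ m<n⇒m%n≡m (toℕ<n j) ⟩
    toℕ j                               ∎)
    where open ≡-Reasoning

  ⊕-inverseˡ : ∀ i t → i ⊕ t ⊕ t * pred n ≡ i
  ⊕-inverseˡ i t = begin
    i ⊕ t ⊕ t * pred n        ≡⟨ ⊕-⊕ i t (t * pred n) ⟩
    i ⊕ (t + t * pred n)      ≡⟨ cong (i ⊕_) (*-suc t (pred n)) ⟨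
    i ⊕ t * suc (pred n)      ≡⟨ cong (λ z → i ⊕ t * z) (suc-pred n) ⟩
    i ⊕ t * n                 ≡⟨ ⊕-multiple i t ⟩
    i                         ∎
    where open ≡-Reasoning

  ⊕-inverseʳ : ∀ i t → i ⊕ t * pred n ⊕ t ≡ i
  ⊕-inverseʳ i t = trans (⊕-comm i (t * pred n) t) (⊕-inverseˡ i t)

  ⊕-translate : ∀ {i j e} d → toℕ j ≡ (toℕ i + e) % n → toℕ (j ⊕ d) ≡ (toℕ (i ⊕ d) + e) % n
  ⊕-translate {i} {j} {e} d j≡i+e = begin
    toℕ (j ⊕ d)              ≡⟨ cong (λ z → toℕ (z ⊕ d)) (toℕ-injective (trans j≡i+e (sym (toℕ-⊕ i e)))) ⟩
    toℕ (i ⊕ e ⊕ d)          ≡⟨ cong toℕ (⊕-comm i e d) ⟩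
    toℕ (i ⊕ d ⊕ e)          ≡⟨ toℕ-⊕ (i ⊕ d) e ⟩
    (toℕ (i ⊕ d) + e) % n    ∎
    where open ≡-Reasoning

  [m+d]%n≢m : ∀ m {d} → 0 < d → d < n → (m + d) % n ≢ m
  [m+d]%n≢m m {d} 0<d d<n eq = <⇒≱ d<n (∣⇒≤ {{>-nonZero 0<d}} (divides ((m + d) / n) d≡qn))
    where
    open ≡-Reasoning
    d≡qn : d ≡ (m + d) / n * n
    d≡qn = +-cancelˡ-≡ m d _ (begin
      m + d                          ≡⟨ m≡m%n+[m/n]*n (m + d) n ⟩
      (m + d) % n + (m + d) / n * n  ≡⟨ cong (_+ (m + d) / n * n) eq ⟩
      m + (m + d) / n * n            ∎)

module _ {n k : ℕ} .{{_ : NonZero n}} where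

  PEdge? : ∀ s t → Dec (PEdge n k s t)
  PEdge? (inj₁ i) (inj₁ j) = map′ (outer i j) (λ { (outer _ _ e) → e }) (toℕ j ≟ (toℕ i + 1) % n)
  PEdge? (inj₁ i) (inj₂ j) = map′ (λ { refl → spoke i }) (λ { (spoke _) → refl }) (i ≟ᶠ j)
  PEdge? (inj₂ i) (inj₁ j) = no λ ()
  PEdge? (inj₂ i) (inj₂ j) = map′ (inner i j) (λ { (inner _ _ e) → e }) (toℕ j ≟ (toℕ i + k) % n)

  PAdj? : Decidable (PAdj n k)
  PAdj? x y = PEdge? _ _ ⊎-dec PEdge? _ _

  PAdj-symmetric : Symmetric (PAdj n k)
  PAdj-symmetric = Sum.swap

  PAdj-join : ∀ s t → PAdj n k (join n n s) (join n n t) ≡ (PEdge n k s t ⊎ PEdge n k t s)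
  PAdj-join s t = cong₂ (λ s t → PEdge n k s t ⊎ PEdge n k t s) (splitAt-join n n s) (splitAt-join n n t)

  PAdj-irreflexive : 1 < n → 0 < k → k < n → ∀ x → ¬ PAdj n k x x
  PAdj-irreflexive 1<n 0<k k<n x = [ PEdge-irreflexive , PEdge-irreflexive ]′
    where
    PEdge-irreflexive : ∀ {s} → ¬ PEdge n k s s
    PEdge-irreflexive (outer i _ eq) = [m+d]%n≢m (toℕ i) (s≤s z≤n) 1<n (sym eq)
    PEdge-irreflexive (inner i _ eq) = [m+d]%n≢m (toℕ i) 0<k k<n (sym eq)

  rotate⊎ : ℕ → Fin n ⊎ Fin n → Fin n ⊎ Fin n
  rotate⊎ t = Sum.map (_⊕ t) (_⊕ t)

  rotate : ℕ → Permutation′ (n + n)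
  rotate t = ↔-trans +↔⊎ (↔-trans rotation (↔-sym +↔⊎))
    where
    rotate⊎-cancel : ∀ a b → (∀ i → i ⊕ a ⊕ b ≡ i) → ∀ s → rotate⊎ b (rotate⊎ a s) ≡ s
    rotate⊎-cancel a b cancel (inj₁ i) = cong inj₁ (cancel i)
    rotate⊎-cancel a b cancel (inj₂ i) = cong inj₂ (cancel i)
    rotation : (Fin n ⊎ Fin n) ↔ (Fin n ⊎ Fin n)
    rotation = mk↔ₛ′ (rotate⊎ t) (rotate⊎ (t * pred n))
      (rotate⊎-cancel (t * pred n) t (λ i → ⊕-inverseʳ i t))
      (rotate⊎-cancel t (t * pred n) (λ i → ⊕-inverseˡ i t))

  rotate-join : ∀ t s → rotate t ⟨$⟩ʳ join n n s ≡ join n n (rotate⊎ t s)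
  rotate-join t s = cong (join n n ∘ rotate⊎ t) (splitAt-join n n s)

  PEdge-rotate : ∀ t {s s′} → PEdge n k s s′ → PEdge n k (rotate⊎ t s) (rotate⊎ t s′)
  PEdge-rotate t (outer i j eq) = outer (i ⊕ t) (j ⊕ t) (⊕-translate t eq)
  PEdge-rotate t (spoke i)      = spoke (i ⊕ t)
  PEdge-rotate t (inner i j eq) = inner (i ⊕ t) (j ⊕ t) (⊕-translate t eq)

  PAdj-rotate : ∀ t → (rotate t ⟨$⟩ʳ_) Preserves PAdj n k ⟶ PAdj n k
  PAdj-rotate t {x} {y} adj =
    subst id (sym (PAdj-join (rotate⊎ t (splitAt n x)) (rotate⊎ t (splitAt n y))))
      (Sum.map (PEdge-rotate t) (PEdge-rotate t) adj)

  InSomeMaximum-orbit : (side : Fin n → Fin n ⊎ Fin n) →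
                        (∀ t i → rotate⊎ t (side i) ≡ side (i ⊕ t)) →
                        ∀ {a} → InSomeMaximum (PAdj n k) (join n n (side a)) →
                        ∀ i → InSomeMaximum (PAdj n k) (join n n (side i))
  InSomeMaximum-orbit side side-rotate {a} a-in-maximum i =
    InSomeMaximum-preimage (rotate t) (PAdj-rotate t) (subst (InSomeMaximum (PAdj n k)) a≡rotate-i a-in-maximum)
    where
    open ≡-Reasoning
    t : ℕ
    t = n ∸ toℕ i + toℕ a
    a≡rotate-i : join n n (side a) ≡ rotate t ⟨$⟩ʳ join n n (side i)
    a≡rotate-i = begin
      join n n (side a)                ≡⟨ cong (join n n ∘ side) (⊕-reaches i a) ⟨
      join n n (side (i ⊕ t))          ≡⟨ cong (join n n) (side-rotate t i) ⟨
      join n n (rotate⊎ t (side i))    ≡⟨ rotate-join t (side i) ⟨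
      rotate t ⟨$⟩ʳ join n n (side i)  ∎

module _ {n k : ℕ} .{{_ : NonZero n}} (1<n : 1 < n) (0<k : 0 < k) (k<n : k < n) where

  private
    v u : Fin n → Fin (n + n)
    v i = join n n (inj₁ i)
    u i = join n n (inj₂ i)

    origin : Fin n
    origin = fromℕ< (>-nonZero⁻¹ n)

  outer-neighbour : ∀ {S} → (∀ j → v j ∉ S) → ∀ {i y} → y ∈ S → PAdj n k (v i) y → y ≡ u i
  outer-neighbour {S} no-v {i} {y} = ∀-join neighbour y
    where
    neighbour : ∀ t → join n n t ∈ S → PAdj n k (v i) (join n n t) → join n n t ≡ u i
    neighbour (inj₁ j) vj∈S _ = ⊥-elim (no-v j vj∈S)
    neighbour (inj₂ j) _ adj with subst id (PAdj-join (inj₁ i) (inj₂ j)) adj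
    ... | inj₁ (spoke _) = refl
    ... | inj₂ ()

  inner-neighbour : ∀ {S} → (∀ j → u j ∉ S) → ∀ {i y} → y ∈ S → PAdj n k (u i) y → y ≡ v i
  inner-neighbour {S} no-u {i} {y} = ∀-join neighbour y
    where
    neighbour : ∀ t → join n n t ∈ S → PAdj n k (u i) (join n n t) → join n n t ≡ v i
    neighbour (inj₂ j) uj∈S _ = ⊥-elim (no-u j uj∈S)
    neighbour (inj₁ j) _ adj with subst id (PAdj-join (inj₂ i) (inj₁ j)) adj
    ... | inj₂ (spoke _) = refl
    ... | inj₁ ()

  maximum-meets-outer : ∀ {S} → MaximumIndependent (PAdj n k) S → ∃ λ i → v i ∈ S
  maximum-meets-outer {S} max with any? (λ i → v i ∈? S)
  ... | yes found = found
  ... | no none   = ⊥-elim (proj₁ max _ _ (u∈S origin) (u∈S (origin ⊕ k)) inner-edge)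
    where
    u∈S : ∀ i → u i ∈ S
    u∈S i = maximum⇒forced PAdj-symmetric max (PAdj-irreflexive 1<n 0<k k<n (v i)) (none ∘ (i ,_))
              (outer-neighbour (λ j → none ∘ (j ,_)))
    inner-edge : PAdj n k (u origin) (u (origin ⊕ k))
    inner-edge = subst id (sym (PAdj-join _ _)) (inj₁ (inner origin (origin ⊕ k) (toℕ-⊕ origin k)))

  maximum-meets-inner : ∀ {S} → MaximumIndependent (PAdj n k) S → ∃ λ i → u i ∈ S
  maximum-meets-inner {S} max with any? (λ i → u i ∈? S)
  ... | yes found = found
  ... | no none   = ⊥-elim (proj₁ max _ _ (v∈S origin) (v∈S (origin ⊕ 1)) outer-edge)
    where
    v∈S : ∀ i → v i ∈ S
    v∈S i = maximum⇒forced PAdj-symmetric max (PAdj-irreflexive 1<n 0<k k<n (u i)) (none ∘ (i ,_))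
              (inner-neighbour (λ j → none ∘ (j ,_)))
    outer-edge : PAdj n k (v origin) (v (origin ⊕ 1))
    outer-edge = subst id (sym (PAdj-join _ _)) (inj₁ (outer origin (origin ⊕ 1) (toℕ-⊕ origin 1)))

  every-vertex-in-maximum : ∀ s → InSomeMaximum (PAdj n k) (join n n s)
  every-vertex-in-maximum s with maximumIndependent-exists (PAdj? {k = k})
  every-vertex-in-maximum (inj₁ i) | S , max =
    InSomeMaximum-orbit inj₁ (λ _ _ → refl) (S , max , proj₂ (maximum-meets-outer max)) i
  every-vertex-in-maximum (inj₂ i) | S , max =
    InSomeMaximum-orbit inj₂ (λ _ _ → refl) (S , max , proj₂ (maximum-meets-inner max)) i

proposition5p1 : (n k : ℕ) → 3 ≤ n → 1 ≤ k → k < n → .{{_ : NonZero n}} →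
    AlphaExcellent (PAdj n k)
proposition5p1 n k 3≤n 1≤k k<n = ∀-join (every-vertex-in-maximum (≤-trans (n≤1+n 2) 3≤n) 1≤k k<n)
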